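{- Let $H$ be a reflexive triangle-free graph, $G$ a reflexive graph, and $\phi,\psi:G\to H$ homomorphisms. Let $\phi=\phi_1,\phi_2,\dots,\phi_d=\psi$ be a walk (reconfiguration) from $\phi$ to $\psi$ in $\operatorname{Hom}(G,H)$, and for each $v\in V(G)$ let $W_v=(\phi_1(v),\dots,\phi_d(v))$ be the trace of $v$. Then the system of walks $(W_v)_{v\in V(G)}$ is topologically valid for $\phi$ and $\psi$.
   Context: A graph is reflexive if every vertex has a loop. $\operatorname{Hom}(G,H)$ has all homomorphisms $G\to H$ as vertices, with $\phi\sim\psi$ if $\phi(u)\psi(v)\in E(H)$ for every edge $uv$ of $G$. A walk in a reflexive graph $K$ is a sequence $(x_0,\dots,x_\ell)$ with $x_{i-1}x_i\in E(K)$ (consecutive vertices may be equal); $(a,b)$-walk and closed walk with basepoint $a$ as usual. For a closed walk $C=(v_0,\dots,v_\ell)$ of $G$, $\phi(C)=(\phi(v_0),\dots,\phi(v_\ell))$. Concatenation $X\cdot Y$, reversal $\overleftarrow{X}$, and $\beta_X(D)=X\cdot D\cdot\overleftarrow{X}$ for an $(a,b)$-walk $X$ and closed walk $D$ at $b$. $\Pi(H;a,b)$ is the graph on $(a,b)$-walks of $H$ where $X=(x_0,\dots,x_\ell)$ and $Y$ are adjacent if (P1) $Y=(x_0,\dots,x_i,x_i,\dots,x_\ell)$, or (P2) $Y=(x_0,\dots,x_{i-1},x_i',x_{i+1},\dots,x_\ell)$ for some $0<i<\ell$ with $x_i'\sim x_i$ and $Y$ a walk (adjacency symmetric); $[X]$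 is the component containing $X$. A system of walks for $\phi,\psi$ is a family $(W_v)_{v\in V(G)}$ where $W_v$ is a $(\phi(v),\psi(v))$-walk in $H$; it is topologically valid if for every $v$ and every closed walk $C$ of $G$ with basepoint $v$, $[\phi(C)]=[\beta_{W_v}(\psi(C))]$. -}

module Defs where

open import Data.Nat using (ℕ; zero; suc)
open import Data.Fin using (Fin; zero; suc; inject₁; fromℕ)
open import Data.List using (List; []; _∷_; _++_; map; reverse; drop; tabulate)
open import Data.Product using (Σ; _×_; _,_)
open import Data.Sum using (_⊎_)
open import Data.Empty using (⊥)
open import Relation.Binary.PropositionalEquality using (_≡_; _≢_)
open import Relation.Binary.Construct.Closure.ReflexiveTransitive using (Star)

record Graph : Set₁ where
  field
    n   : ℕ
    E   : Fin n → Fin n → Set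
    sym : ∀ {x y} → E x y → E y x

  V : Set
  V = Fin n

open Graph public

Reflexive : Graph → Set
Reflexive K = ∀ x → E K x x

TriangleFree : Graph → Set
TriangleFree K = ∀ x y z → x ≢ y → y ≢ z → x ≢ z →
                 E K x y → E K y z → E K x z → ⊥

IsHom : (G H : Graph) → (V G → V H) → Set
IsHom G H φ = ∀ u v → E G u v → E H (φ u) (φ v)

HomAdj : (G H : Graph) → (V G → V H) → (V G → V H) → Set
HomAdj G H φ ψ = ∀ u v → E G u v → E H (φ u) (ψ v)

data IsWalk (K : Graph) : V K → V K → List (V K) → Set where
  single : ∀ {a} → IsWalk K a a (a ∷ [])
  cons   : ∀ {a b c xs} → E K a b → IsWalk K b c (b ∷ xs) → IsWalk K a c (a ∷ b ∷ xs)

-- Concatenation X·Y of an (a,b)-walk and a (b,c)-walk: (x₀,…,x_ℓ,y₁,…,y_m)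
_·_ : ∀ {A : Set} → List A → List A → List A
X · Y = X ++ drop 1 Y

β : ∀ {A : Set} → List A → List A → List A
β X D = (X · D) · reverse X

data Dup {A : Set} : List A → List A → Set where
  here  : ∀ {x xs} → Dup (x ∷ xs) (x ∷ x ∷ xs)
  there : ∀ {x xs ys} → Dup xs ys → Dup (x ∷ xs) (x ∷ ys)

data ReplNonLast (K : Graph) : List (V K) → List (V K) → Set where
  here  : ∀ {x x' y ys} → E K x' x → ReplNonLast K (x ∷ y ∷ ys) (x' ∷ y ∷ ys)
  there : ∀ {x xs ys} → ReplNonLast K xs ys → ReplNonLast K (x ∷ xs) (x ∷ ys)

-- (P2): replace an interior entry x_i (0 < i < ℓ) by an adjacent x_i'
data Repl (K : Graph) : List (V K) → List (V K) → Set where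
  interior : ∀ {x xs ys} → ReplNonLast K xs ys → Repl K (x ∷ xs) (x ∷ ys)

PiAdj : (K : Graph) → V K → V K → List (V K) → List (V K) → Set
PiAdj K a b X Y =
  IsWalk K a b X × IsWalk K a b Y ×
  (Dup X Y ⊎ Dup Y X ⊎ Repl K X Y ⊎ Repl K Y X)

SameComp : (K : Graph) → V K → V K → List (V K) → List (V K) → Set
SameComp K a b X Y = Star (PiAdj K a b) X Y

TopValid : (G H : Graph) → (φ ψ : V G → V H) → (W : V G → List (V H)) → Set
TopValid G H φ ψ W =
  ∀ v (C : List (V G)) → IsWalk G v v C →
  SameComp H (φ v) (φ v) (map φ C) (β (W v) (map ψ C))

trace : ∀ {A B : Set} {d : ℕ} → (Fin (suc d) → A → B) → A → List B
trace f v = tabulate (λ i → f i v)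

-- Two adjacent homomorphisms φ ∼ ψ are homotopic in the sense of Π: for a walk
-- C = (u, …, w) of G, the image φ(C) can be deformed to (φ u)·ψ(C)·(φ w) by
-- pushing the walk across, one edge uv at a time, through the square
-- φ u, φ v, ψ v, ψ u, which is filled by the edges φ u ψ v and φ v ψ u
-- (a single interior replacement). For a closed walk at v this says
-- [φ(C)] = [β_{(φ v, ψ v)}(ψ(C))]; conjugating the components of Π along the
-- trace and inducting over the reconfiguration gives the theorem.
module Submission where

open import Defs
open import Function using (_∘_)
open import Data.Nat using (ℕ; zero; suc)
open import Data.Fin using (Fin; zero; suc; inject₁; fromℕ)
open import Data.List using (List; []; _∷_; _++_; map; reverse; drop; tabulate)
open import Data.List.Properties using (unfold-reverse; ++-assoc; ++-identityʳ)
open import Data.Product using (_,_)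
open import Data.Sum using (_⊎_; inj₁; inj₂)
open import Relation.Binary.PropositionalEquality
  using (_≡_; refl; cong; subst; module ≡-Reasoning)
  renaming (sym to ≡-sym)
open import Relation.Binary.Construct.Closure.ReflexiveTransitive
  using (ε; _◅_; _◅◅_)
  renaming (reverse to Star-reverse)

β-∷ : ∀ {A : Set} (a b : A) xs D →
      a ∷ β (b ∷ xs) D ++ a ∷ [] ≡ β (a ∷ b ∷ xs) D
β-∷ a b xs D = cong (a ∷_) (begin
  (P ++ drop 1 (reverse (b ∷ xs))) ++ a ∷ []  ≡⟨ ++-assoc P _ (a ∷ []) ⟩
  P ++ drop 1 (reverse (b ∷ xs)) ++ a ∷ []    ≡⟨ cong (P ++_) (≡-sym drop-1-reverse) ⟩
  P ++ drop 1 (reverse (a ∷ b ∷ xs))          ∎)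
  where
  open ≡-Reasoning
  P = (b ∷ xs) ++ drop 1 D

  drop-1-snoc : ∀ ys y z → drop 1 ((ys ++ y ∷ []) ++ z ∷ []) ≡ drop 1 (ys ++ y ∷ []) ++ z ∷ []
  drop-1-snoc []      y z = refl
  drop-1-snoc (_ ∷ _) y z = refl

  drop-1-reverse : drop 1 (reverse (a ∷ b ∷ xs)) ≡ drop 1 (reverse (b ∷ xs)) ++ a ∷ []
  drop-1-reverse rewrite unfold-reverse a (b ∷ xs) | unfold-reverse b xs =
    drop-1-snoc (reverse xs) b a

module _ (K : Graph) where

  Move : List (V K) → List (V K) → Set
  Move X Y = Dup X Y ⊎ Dup Y X ⊎ Repl K X Y ⊎ Repl K Y X

  Move-sym : ∀ {X Y} → Move X Y → Move Y X
  Move-sym (inj₁ d)               = inj₂ (inj₁ d)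
  Move-sym (inj₂ (inj₁ d))        = inj₁ d
  Move-sym (inj₂ (inj₂ (inj₁ r))) = inj₂ (inj₂ (inj₂ r))
  Move-sym (inj₂ (inj₂ (inj₂ r))) = inj₂ (inj₂ (inj₁ r))

  Move-∷ : ∀ {X Y} a → Move X Y → Move (a ∷ X) (a ∷ Y)
  Move-∷ a (inj₁ d)                          = inj₁ (there d)
  Move-∷ a (inj₂ (inj₁ d))                   = inj₂ (inj₁ (there d))
  Move-∷ a (inj₂ (inj₂ (inj₁ (interior r)))) = inj₂ (inj₂ (inj₁ (interior (there r))))
  Move-∷ a (inj₂ (inj₂ (inj₂ (interior r)))) = inj₂ (inj₂ (inj₂ (interior (there r))))

  Dup-++ʳ : ∀ {X Y : List (V K)} s → Dup X Y → Dup (X ++ s) (Y ++ s)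
  Dup-++ʳ s here      = here
  Dup-++ʳ s (there d) = there (Dup-++ʳ s d)

  ReplNonLast-++ʳ : ∀ {X Y} s → ReplNonLast K X Y → ReplNonLast K (X ++ s) (Y ++ s)
  ReplNonLast-++ʳ s (here e)  = here e
  ReplNonLast-++ʳ s (there r) = there (ReplNonLast-++ʳ s r)

  Move-++ʳ : ∀ {X Y} s → Move X Y → Move (X ++ s) (Y ++ s)
  Move-++ʳ s (inj₁ d)        = inj₁ (Dup-++ʳ s d)
  Move-++ʳ s (inj₂ (inj₁ d)) = inj₂ (inj₁ (Dup-++ʳ s d))
  Move-++ʳ s (inj₂ (inj₂ (inj₁ (interior r)))) =
    inj₂ (inj₂ (inj₁ (interior (ReplNonLast-++ʳ s r))))
  Move-++ʳ s (inj₂ (inj₂ (inj₂ (interior r)))) =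
    inj₂ (inj₂ (inj₂ (interior (ReplNonLast-++ʳ s r))))

  IsWalk-∷ : ∀ {a b c X} → E K a b → IsWalk K b c X → IsWalk K a c (a ∷ X)
  IsWalk-∷ e single      = cons e single
  IsWalk-∷ e (cons e′ w) = cons e (cons e′ w)

  IsWalk-++-∷ : ∀ {a b c X} → IsWalk K a b X → E K b c → IsWalk K a c (X ++ c ∷ [])
  IsWalk-++-∷ single      e = cons e single
  IsWalk-++-∷ (cons e′ w) e = cons e′ (IsWalk-++-∷ w e)

  SameComp-sym : ∀ {a b X Y} → SameComp K a b X Y → SameComp K a b Y X
  SameComp-sym = Star-reverse λ (wX , wY , m) → wY , wX , Move-sym m

  SameComp-∷ : ∀ {a b c X Y} → E K a b →
               SameComp K b c X Y → SameComp K a c (a ∷ X) (a ∷ Y)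
  SameComp-∷ e ε = ε
  SameComp-∷ {a} e ((wX , wY , m) ◅ r) =
    (IsWalk-∷ e wX , IsWalk-∷ e wY , Move-∷ a m) ◅ SameComp-∷ e r

  SameComp-++-∷ : ∀ {a b c X Y} → E K b c →
                  SameComp K a b X Y → SameComp K a c (X ++ c ∷ []) (Y ++ c ∷ [])
  SameComp-++-∷ e ε = ε
  SameComp-++-∷ {c = c} e ((wX , wY , m) ◅ r) =
    (IsWalk-++-∷ wX e , IsWalk-++-∷ wY e , Move-++ʳ (c ∷ []) m) ◅ SameComp-++-∷ e r

  SameComp-conj : ∀ {a b X Y} → E K a b →
                  SameComp K b b X Y → SameComp K a a (a ∷ X ++ a ∷ []) (a ∷ Y ++ a ∷ [])
  SameComp-conj e = SameComp-++-∷ (sym K e) ∘ SameComp-∷ e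

  -- [c, b, c] → [c, c, c] → [c, c] → [c], prefixed by the rest of X.
  SameComp-backtrack : Reflexive K → ∀ {a b c X} → IsWalk K a c X → E K c b →
                       SameComp K a c (X ++ b ∷ c ∷ []) X
  SameComp-backtrack refl-K {c = c} single e =
    (cons e (cons (sym K e) single) , cons l (cons l single) , inj₂ (inj₂ (inj₁ (interior (here e))))) ◅
    (cons l (cons l single) , cons l single , inj₂ (inj₁ here)) ◅
    (cons l single , single , inj₂ (inj₁ here)) ◅ ε
    where l = refl-K c
  SameComp-backtrack refl-K (cons e′ w) e = SameComp-∷ e′ (SameComp-backtrack refl-K w e)

IsWalk-map : ∀ {G H χ} → IsHom G H χ → ∀ {u w C} →
             IsWalk G u w C → IsWalk H (χ u) (χ w) (map χ C)
IsWalk-map h single              = single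
IsWalk-map h (cons {a} {b} e w) = cons (h a b e) (IsWalk-map h w)

module _ (G H : Graph) (refl-G : Reflexive G) (refl-H : Reflexive H)
         {φ ψ : V G → V H} (hom-φ : IsHom G H φ) (hom-ψ : IsHom G H ψ)
         (φ∼ψ : HomAdj G H φ ψ) where

  -- Each step replaces the entry ψ u right after φ u by φ u′, using the edge φ u′ ψ u.
  HomAdj-slide : ∀ {u w C} → IsWalk G u w C →
                 SameComp H (φ u) (φ w) (φ u ∷ map ψ C ++ φ w ∷ []) (map φ C ++ ψ w ∷ φ w ∷ [])
  HomAdj-slide single = ε
  HomAdj-slide {u} {w} (cons {b = u′} e c) =
    (walk-ψu , walk-φu′ , inj₂ (inj₂ (inj₁ (interior (here (φ∼ψ u′ u (sym G e))))))) ◅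
    SameComp-∷ H (hom-φ u u′ e) (HomAdj-slide c)
    where
    tail = IsWalk-++-∷ H (IsWalk-map hom-ψ c) (sym H (φ∼ψ w w (refl-G w)))
    walk-ψu  = cons (φ∼ψ u u (refl-G u)) (cons (hom-ψ u u′ e) tail)
    walk-φu′ = cons (hom-φ u u′ e) (cons (φ∼ψ u′ u′ (refl-G u′)) tail)

  HomAdj-sameComp : ∀ {u w C} → IsWalk G u w C →
                    SameComp H (φ u) (φ w) (map φ C) (φ u ∷ map ψ C ++ φ w ∷ [])
  HomAdj-sameComp c = SameComp-sym H
    (HomAdj-slide c ◅◅ SameComp-backtrack H refl-H (IsWalk-map hom-φ c) (φ∼ψ _ _ (refl-G _)))

trace-topValid : (G H : Graph) → Reflexive G → Reflexive H →
                 (d : ℕ) (f : Fin (suc d) → V G → V H) →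
                 (∀ i → IsHom G H (f i)) →
                 (∀ (i : Fin d) → HomAdj G H (f (inject₁ i)) (f (suc i))) →
                 TopValid G H (f zero) (f (fromℕ d)) (trace f)
trace-topValid G H refl-G refl-H zero f homs adjs v _ single = ε
trace-topValid G H refl-G refl-H zero f homs adjs v (_ ∷ D) (cons _ _)
  rewrite ++-identityʳ (map (f zero) D) = ε
trace-topValid G H refl-G refl-H (suc d) f homs adjs v C c =
  HomAdj-sameComp G H refl-G refl-H (homs zero) (homs (suc zero)) (adjs zero) c ◅◅
  subst (SameComp H (f zero v) (f zero v) _)
        (β-∷ (f zero v) (f (suc zero) v) (tabulate λ (i : Fin d) → f (suc (suc i)) v) (map (f (fromℕ (suc d))) C))
        (SameComp-conj H (adjs zero v v (refl-G v))
          (trace-topValid G H refl-G refl-H d (f ∘ suc) (homs ∘ suc) (adjs ∘ suc) v C c))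

fact4p2 : (G H : Graph) → Reflexive G → Reflexive H → TriangleFree H →
          (d : ℕ) (f : Fin (suc d) → V G → V H) →
          (∀ i → IsHom G H (f i)) →
          (∀ (i : Fin d) → HomAdj G H (f (inject₁ i)) (f (suc i))) →
          TopValid G H (f zero) (f (fromℕ d)) (trace f)
fact4p2 G H refl-G refl-H _ = trace-topValid G H refl-G refl-H
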